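{- Let $F:\mathbf{Sets}\to\mathbf{Sets}$ be a functor, $A$ a set, and $\sqsubseteq$ a side stable order on $F^A$ with decomposition $\sqsubseteq=\prod_{a\in A}\sqsubseteq^a$ and a partition $\{A^l,A^r\}$ of $A$ such that $\sqsubseteq^a$ is right-stable for $a\in A^r$ and left-stable for $a\in A^l$. Define $\sqsubseteq^{\bar r}$ and $\sqsubseteq^{\bar l}$ on $F^A$ by: $f\sqsubseteq^{\bar r}_X g$ iff $f(a)\sqsubseteq^a_X g(a)$ for all $a\in A^r$ and $f(a)=g(a)$ for all $a\in A^l$; $f\sqsubseteq^{\bar l}_X g$ iff $f(a)\sqsubseteq^a_X g(a)$ for all $a\in A^l$ and $f(a)=g(a)$ for all $a\in A^r$. Then for any coalgebras $c:X\to(FX)^A$, $d:Y\to(FY)^A$, a relation $R\subseteq X\times Y$ is a $\sqsubseteq$-simulation if and only if for all $(x,y)\in R$, $(c(x),d(y))\in{\sqsubseteq^{\bar r}_Y}\circ\mathrm{Rel}(F^A)(R)\circ{\sqsubseteq^{\bar l}_X}$, i.e. there exist $u\in(FX)^A$, $v\in(FY)^A$ with $c(x)\sqsubseteq^{\bar l}_X u$, $(u,v)\in\mathrm{Rel}(F^A)(R)$ and $v\sqsubseteq^{\bar r}_Y d(y)$.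
   Context: $F^A$ is the functor $X\mapsto(FX)^A$ with $F^Af(\alpha)(a)=Ff(\alpha(a))$. An order on a functor $G$ is a family of preorders $\sqsubseteq_X\subseteq GX\times GX$ with $u\sqsubseteq_X u'\Rightarrow Gf(u)\sqsubseteq_Y Gf(u')$ for all $f:X\to Y$. Right-stable: for every $f:X\to Y$, $u\in GX$, $v\in GY$ with $v\sqsubseteq_Y Gf(u)$ there is $u'$ with $Gf(u')=v$ and $u'\sqsubseteq_X u$. Left-stable: for every $f:X\to Y$, $u\in GX$, $v\in GY$ with $Gf(u)\sqsubseteq_Y v$ there is $u'$ with $u\sqsubseteq_X u'$ and $Gf(u')=v$. Action-distributive: $\sqsubseteq=\prod_a\sqsubseteq^a$ means there are orders $\sqsubseteq^a$ on $F$ with $f\sqsubseteq_X g$ iff $f(a)\sqsubseteq^a_X g(a)$ for all $a$; side stable: moreover each $\sqsubseteq^a$ is right- or left-stable. For $R\subseteq X_1\times X_2$ with projections $r_1,r_2$: $\mathrm{Rel}(G)(R)=\{(u,v)\mid\exists w\in G(R).\,Gr_1(w)=u,\ Gr_2(w)=v\}$ and $\mathrm{Rel}_{\sqsubseteq}(G)(R)=\{(u,v)\mid\exists w\in G(R).\,u\sqsubseteq_{X_1}Gr_1(w)\wedge Gr_2(w)\sqsubseteq_{X_2}v\}$. A $\sqsubseteq$-simulation for $c:X\to GX$, $d:Y\to GY$ is a relation $R\subseteq X\times Y$ with $(c(x),d(y))\in\mathrm{Rel}_{\sqsubseteq}(G)(R)$ for all $(x,y)\in R$. Composition: $T\circ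 S=\{(p,t)\mid\exists q.\,(p,q)\in S,(q,t)\in T\}$. -}

module Defs where

open import Data.Product using (Σ; Σ-syntax; _×_; _,_; proj₁; proj₂)
open import Relation.Binary.PropositionalEquality using (_≡_)

record Functor : Set₁ where
  field
    F₀    : Set → Set
    F₁    : {X Y : Set} → (X → Y) → F₀ X → F₀ Y
    F-id  : {X : Set} (u : F₀ X) → F₁ (λ x → x) u ≡ u
    F-∘   : {X Y Z : Set} (f : X → Y) (g : Y → Z) (u : F₀ X) →
            F₁ (λ x → g (f x)) u ≡ F₁ g (F₁ f u)
open Functor public

Exp₀ : Functor → Set → Set → Set
Exp₀ F A X = A → F₀ F X

Exp₁ : (F : Functor) (A : Set) {X Y : Set} → (X → Y) → Exp₀ F A X → Exp₀ F A Y
Exp₁ F A f α a = F₁ F f (α a)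

RelFam : (Set → Set) → Set₁
RelFam G₀ = (X : Set) → G₀ X → G₀ X → Set

record IsOrder (G₀ : Set → Set) (G₁ : {X Y : Set} → (X → Y) → G₀ X → G₀ Y)
               (⊑ : RelFam G₀) : Set₁ where
  field
    refl′  : {X : Set} (u : G₀ X) → ⊑ X u u
    trans′ : {X : Set} {u v w : G₀ X} → ⊑ X u v → ⊑ X v w → ⊑ X u w
    mono   : {X Y : Set} (f : X → Y) {u u′ : G₀ X} → ⊑ X u u′ → ⊑ Y (G₁ f u) (G₁ f u′)

OrderOnF : (F : Functor) → RelFam (F₀ F) → Set₁
OrderOnF F ⊑ = IsOrder (F₀ F) (F₁ F) ⊑

RightStable : (F : Functor) → RelFam (F₀ F) → Set₁
RightStable F ⊑ = {X Y : Set} (f : X → Y) (u : F₀ F X) (v : F₀ F Y) →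
  ⊑ Y v (F₁ F f u) → Σ[ u′ ∈ F₀ F X ] (F₁ F f u′ ≡ v × ⊑ X u′ u)

LeftStable : (F : Functor) → RelFam (F₀ F) → Set₁
LeftStable F ⊑ = {X Y : Set} (f : X → Y) (u : F₀ F X) (v : F₀ F Y) →
  ⊑ Y (F₁ F f u) v → Σ[ u′ ∈ F₀ F X ] (⊑ X u u′ × F₁ F f u′ ≡ v)

-- The two blocks {A^l, A^r} of the partition of A, given by a labelling.
data Side : Set where
  left right : Side

Graph : {X Y : Set} → (X → Y → Set) → Set
Graph {X} {Y} R = Σ[ p ∈ X × Y ] R (proj₁ p) (proj₂ p)

r₁ : {X Y : Set} {R : X → Y → Set} → Graph R → X
r₁ ((x , _) , _) = x

r₂ : {X Y : Set} {R : X → Y → Set} → Graph R → Y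
r₂ ((_ , y) , _) = y

-- Rel(F^A)(R): equality in (F X)^A is equality of functions, i.e. pointwise.
RelExp : (F : Functor) (A : Set) {X Y : Set} (R : X → Y → Set) →
         Exp₀ F A X → Exp₀ F A Y → Set
RelExp F A R u v = Σ[ w ∈ Exp₀ F A (Graph R) ]
  (((a : A) → Exp₁ F A r₁ w a ≡ u a) × ((a : A) → Exp₁ F A r₂ w a ≡ v a))

RelExp⊑ : (F : Functor) (A : Set) (⊑ : RelFam (Exp₀ F A)) {X Y : Set}
          (R : X → Y → Set) → Exp₀ F A X → Exp₀ F A Y → Set
RelExp⊑ F A ⊑ {X} {Y} R u v = Σ[ w ∈ Exp₀ F A (Graph R) ]
  (⊑ X u (Exp₁ F A r₁ w) × ⊑ Y (Exp₁ F A r₂ w) v)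

IsSimulation : (F : Functor) (A : Set) (⊑ : RelFam (Exp₀ F A)) {X Y : Set}
               (c : X → Exp₀ F A X) (d : Y → Exp₀ F A Y) (R : X → Y → Set) → Set
IsSimulation F A ⊑ c d R = ∀ x y → R x y → RelExp⊑ F A ⊑ R (c x) (d y)

-- ⊑^{r̄} and ⊑^{l̄} built from the components ⊑^a and the partition.
-- ⊑^{r̄}: components ⊑^a for a ∈ A^r, equality for a ∈ A^l.
-- ⊑^{l̄}: components ⊑^a for a ∈ A^l, equality for a ∈ A^r.
-- "a belongs to block s" gives the component order, the other block gives equality.
onSide : {B : Set} (s t : Side) → (B → B → Set) → B → B → Set
onSide left  left  ⊑ u v = ⊑ u v
onSide right right ⊑ u v = ⊑ u v
onSide left  right ⊑ u v = u ≡ v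
onSide right left  ⊑ u v = u ≡ v

OnSide : (F : Functor) {A : Set} (⊑ᵃ : A → RelFam (F₀ F)) (side : A → Side)
         (s : Side) → RelFam (Exp₀ F A)
OnSide F {A} ⊑ᵃ side s X f g = (a : A) → onSide s (side a) (⊑ᵃ a X) (f a) (g a)

⊑r̄ ⊑l̄ : (F : Functor) {A : Set} (⊑ᵃ : A → RelFam (F₀ F)) (side : A → Side) →
         RelFam (Exp₀ F A)
⊑r̄ F ⊑ᵃ side = OnSide F ⊑ᵃ side right
⊑l̄ F ⊑ᵃ side = OnSide F ⊑ᵃ side left

{-# OPTIONS --safe #-}
-- A pair (u , v) lies in Rel_⊑(F^A)(R) when some w ∈ (F R)^A has u ⊑ F^A r₁ w and
-- F^A r₂ w ⊑ v. Work componentwise: at a right-stable a, right stability replaces w a by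
-- some w′ with F r₁ w′ = u a and w′ ⊑ w a, so monotonicity and transitivity keep
-- F r₂ w′ ⊑ v a; at a left-stable a, symmetrically. The resulting witness exhibits
-- (u , v) in ⊑^r̄ ∘ Rel(F^A)(R) ∘ ⊑^l̄ through (F^A r₁ w′ , F^A r₂ w′). Conversely, the
-- equalities in ⊑^l̄ and ⊑^r̄ weaken to ⊑ᵃ by reflexivity.
module Submission where

open import Defs
open import Data.Product using (Σ-syntax; _×_; _,_; proj₁; proj₂)
open import Function.Bundles using (_⇔_; mk⇔; Equivalence)
open import Relation.Binary.PropositionalEquality using (_≡_; refl; sym; subst)

open IsOrder
open Equivalence

onSide⇒ : {B : Set} {⊑ : B → B → Set} → ((u : B) → ⊑ u u) →
          (s t : Side) {u v : B} → onSide s t ⊑ u v → ⊑ u v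
onSide⇒ ⊑-refl left  left  u⊑v  = u⊑v
onSide⇒ ⊑-refl right right u⊑v  = u⊑v
onSide⇒ ⊑-refl left  right refl = ⊑-refl _
onSide⇒ ⊑-refl right left  refl = ⊑-refl _

module _ (F : Functor) {⊑ : RelFam (F₀ F)} (ord : OrderOnF F ⊑)
         {G X Y : Set} (p₁ : G → X) (p₂ : G → Y)
         {u : F₀ F X} {v : F₀ F Y} (w : F₀ F G)
         (u⊑p₁w : ⊑ X u (F₁ F p₁ w)) (p₂w⊑v : ⊑ Y (F₁ F p₂ w) v) where

  rightStable-absorbˡ : RightStable F ⊑ →
    Σ[ w′ ∈ F₀ F G ] (u ≡ F₁ F p₁ w′ × ⊑ Y (F₁ F p₂ w′) v)
  rightStable-absorbˡ rs with rs p₁ w u u⊑p₁w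
  ... | w′ , p₁w′≡u , w′⊑w = w′ , sym p₁w′≡u , trans′ ord (mono ord p₂ w′⊑w) p₂w⊑v

  leftStable-absorbʳ : LeftStable F ⊑ →
    Σ[ w′ ∈ F₀ F G ] (⊑ X u (F₁ F p₁ w′) × F₁ F p₂ w′ ≡ v)
  leftStable-absorbʳ ls with ls p₂ w v p₂w⊑v
  ... | w′ , w⊑w′ , p₂w′≡v = w′ , trans′ ord u⊑p₁w (mono ord p₁ w⊑w′) , p₂w′≡v

  absorb-onSide : (s : Side) → (s ≡ right → RightStable F ⊑) → (s ≡ left → LeftStable F ⊑) →
    Σ[ w′ ∈ F₀ F G ] (onSide left s (⊑ X) u (F₁ F p₁ w′) × onSide right s (⊑ Y) (F₁ F p₂ w′) v)
  absorb-onSide left  _  ls = leftStable-absorbʳ (ls refl)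
  absorb-onSide right rs _  = rightStable-absorbˡ (rs refl)

⊑r̄∘RelExp∘⊑l̄ : (F : Functor) {A : Set} (⊑ᵃ : A → RelFam (F₀ F)) (side : A → Side)
               {X Y : Set} (R : X → Y → Set) → Exp₀ F A X → Exp₀ F A Y → Set
⊑r̄∘RelExp∘⊑l̄ F {A} ⊑ᵃ side {X} {Y} R u v = Σ[ u′ ∈ Exp₀ F A X ] Σ[ v′ ∈ Exp₀ F A Y ]
  (⊑l̄ F ⊑ᵃ side X u u′ × RelExp F A R u′ v′ × ⊑r̄ F ⊑ᵃ side Y v′ v)

module _ (F : Functor) (A : Set) (⊑ : RelFam (Exp₀ F A))
         (⊑ᵃ : A → RelFam (F₀ F)) (ordᵃ : (a : A) → OrderOnF F (⊑ᵃ a))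
         (⊑-pointwise : (X : Set) (f g : Exp₀ F A X) → ⊑ X f g ⇔ ((a : A) → ⊑ᵃ a X (f a) (g a)))
         (side : A → Side)
         (rs : (a : A) → side a ≡ right → RightStable F (⊑ᵃ a))
         (ls : (a : A) → side a ≡ left → LeftStable F (⊑ᵃ a))
         {X Y : Set} (R : X → Y → Set) {u : Exp₀ F A X} {v : Exp₀ F A Y} where

  RelExp⊑⇒⊑r̄∘RelExp∘⊑l̄ : RelExp⊑ F A ⊑ R u v → ⊑r̄∘RelExp∘⊑l̄ F ⊑ᵃ side R u v
  RelExp⊑⇒⊑r̄∘RelExp∘⊑l̄ (w , u⊑r₁w , r₂w⊑v) =
    Exp₁ F A r₁ w′ , Exp₁ F A r₂ w′ ,
    (λ a → proj₁ (proj₂ (absorbed a))) ,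
    (w′ , (λ _ → refl) , (λ _ → refl)) ,
    (λ a → proj₂ (proj₂ (absorbed a)))
    where
    absorbed : (a : A) → Σ[ w′ ∈ F₀ F (Graph R) ]
      (onSide left (side a) (⊑ᵃ a X) (u a) (F₁ F r₁ w′) ×
       onSide right (side a) (⊑ᵃ a Y) (F₁ F r₂ w′) (v a))
    absorbed a = absorb-onSide F (ordᵃ a) r₁ r₂ (w a)
      (to (⊑-pointwise X _ _) u⊑r₁w a) (to (⊑-pointwise Y _ _) r₂w⊑v a)
      (side a) (rs a) (ls a)

    w′ : Exp₀ F A (Graph R)
    w′ a = proj₁ (absorbed a)

  ⊑r̄∘RelExp∘⊑l̄⇒RelExp⊑ : ⊑r̄∘RelExp∘⊑l̄ F ⊑ᵃ side R u v → RelExp⊑ F A ⊑ R u v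
  ⊑r̄∘RelExp∘⊑l̄⇒RelExp⊑ (u′ , v′ , u⊑u′ , (w , r₁w≡u′ , r₂w≡v′) , v′⊑v) =
    w , from (⊑-pointwise X _ _) u⊑r₁w , from (⊑-pointwise Y _ _) r₂w⊑v
    where
    u⊑r₁w : (a : A) → ⊑ᵃ a X (u a) (F₁ F r₁ (w a))
    u⊑r₁w a = subst (⊑ᵃ a X (u a)) (sym (r₁w≡u′ a))
      (onSide⇒ (refl′ (ordᵃ a)) left (side a) (u⊑u′ a))

    r₂w⊑v : (a : A) → ⊑ᵃ a Y (F₁ F r₂ (w a)) (v a)
    r₂w⊑v a = subst (λ z → ⊑ᵃ a Y z (v a)) (sym (r₂w≡v′ a))
      (onSide⇒ (refl′ (ordᵃ a)) right (side a) (v′⊑v a))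

proposition4 : (F : Functor) (A : Set) (⊑ : RelFam (Exp₀ F A))
    → IsOrder (Exp₀ F A) (Exp₁ F A) ⊑
    → (⊑ᵃ : A → RelFam (F₀ F))
    → ((a : A) → OrderOnF F (⊑ᵃ a))
    → ((X : Set) (f g : Exp₀ F A X) → ⊑ X f g ⇔ ((a : A) → ⊑ᵃ a X (f a) (g a)))
    → (side : A → Side)
    → ((a : A) → side a ≡ right → RightStable F (⊑ᵃ a))
    → ((a : A) → side a ≡ left → LeftStable F (⊑ᵃ a))
    → {X Y : Set} (c : X → Exp₀ F A X) (d : Y → Exp₀ F A Y) (R : X → Y → Set)
    → IsSimulation F A ⊑ c d R
      ⇔ (∀ x y → R x y → Σ[ u ∈ Exp₀ F A X ] Σ[ v ∈ Exp₀ F A Y ]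
           (⊑l̄ F ⊑ᵃ side X (c x) u × RelExp F A R u v × ⊑r̄ F ⊑ᵃ side Y v (d y)))
proposition4 F A ⊑ _ ⊑ᵃ ordᵃ ⊑-pointwise side rs ls c d R = mk⇔
  (λ sim x y xRy → RelExp⊑⇒⊑r̄∘RelExp∘⊑l̄ F A ⊑ ⊑ᵃ ordᵃ ⊑-pointwise side rs ls R (sim x y xRy))
  (λ fac x y xRy → ⊑r̄∘RelExp∘⊑l̄⇒RelExp⊑ F A ⊑ ⊑ᵃ ordᵃ ⊑-pointwise side rs ls R (fac x y xRy))
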